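{- Let $\sigma\in\mathfrak{S}_n$. For each $x\in[n]$, $\mathrm{ai}(\sigma)=\mathrm{ai}(\varphi'_x(\sigma))$.
   Context: Permutations $\sigma\in\mathfrak{S}_n$ are written as words $\sigma_1\cdots\sigma_n$, with the convention $\sigma_0=\sigma_{n+1}=+\infty$. The entry $\sigma_i$ ($1\le i\le n$) is a double descent (resp. double ascent, peak, valley) if $\sigma_{i-1}>\sigma_i>\sigma_{i+1}$ (resp. $\sigma_{i-1}<\sigma_i<\sigma_{i+1}$, $\sigma_{i-1}<\sigma_i>\sigma_{i+1}$, $\sigma_{i-1}>\sigma_i<\sigma_{i+1}$). For $x\in[n]$, the $x$-factorization of $\sigma$ is $\sigma=w_1w_2xw_3w_4$ where $w_2$ (resp. $w_3$) is the maximal contiguous subword immediately left (resp. right) of $x$ all of whose letters are smaller than $x$; set $\varphi_x(\sigma)=w_1w_3xw_2w_4$. Define $\varphi'_x(\sigma)=\varphi_x(\sigma)$ if $x$ is a double ascent or double descent of $\sigma$, and $\varphi'_x(\sigma)=\sigma$ if $x$ is a peak or valley. For a word $w=w_1\cdots w_k$ with distinct letters, an admissible inversion is a pair $(w_i,w_j)$ with $i<j$, $w_i>w_j$, and either ($i>1$ and $w_{i-1}<w_i$) or there is $l$ with $i<l<j$ and $w_i<w_l$; $\mathrm{ai}(w)$ is the number of admissible inversions. -}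

module Defs where

open import Data.Nat using (ℕ; zero; suc; _+_; _<_; _<ᵇ_; _≡ᵇ_; _<?_)
open import Data.Bool using (Bool; true; false; _∧_; _∨_; if_then_else_)
open import Data.Maybe using (Maybe; just; nothing)
open import Data.Product using (_×_; _,_; proj₁; proj₂)
open import Data.List using (List; []; _∷_; _++_; [_]; reverse; takeWhile; dropWhile; length; foldr; map; upTo; head; allFin)
open import Data.Bool.ListAction using (any)
open import Data.Fin using (Fin; toℕ)
open import Data.List using (lookup)

-- Permutations of [n] = {1,…,n} are lists of naturals that are a
-- rearrangement of this list.
[1‥_] : ℕ → List ℕ
[1‥ n ] = map suc (upTo n)

splitAt : ℕ → List ℕ → List ℕ × List ℕ
splitAt x [] = [] , []
splitAt x (y ∷ ys) with y ≡ᵇ x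
... | true  = [] , ys
... | false = y ∷ proj₁ (splitAt x ys) , proj₂ (splitAt x ys)

-- x-factorization components  σ = w₁ w₂ x w₃ w₄
w₁ w₂ w₃ w₄ : ℕ → List ℕ → List ℕ
w₁ x σ = reverse (dropWhile (_<? x) (reverse (proj₁ (splitAt x σ))))
w₂ x σ = reverse (takeWhile (_<? x) (reverse (proj₁ (splitAt x σ))))
w₃ x σ = takeWhile (_<? x) (proj₂ (splitAt x σ))
w₄ x σ = dropWhile (_<? x) (proj₂ (splitAt x σ))

φ : ℕ → List ℕ → List ℕ
φ x σ = w₁ x σ ++ w₃ x σ ++ [ x ] ++ w₂ x σ ++ w₄ x σ

-- Neighbours of x in σ; `nothing` encodes the boundary value +∞.
leftNb rightNb : ℕ → List ℕ → Maybe ℕ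
leftNb  x σ = head (reverse (proj₁ (splitAt x σ)))
rightNb x σ = head (proj₂ (splitAt x σ))

nb<x x<nb : Maybe ℕ → ℕ → Bool
nb<x nothing  x = false
nb<x (just a) x = a <ᵇ x
x<nb nothing  x = true
x<nb (just a) x = x <ᵇ a

isDoubleAscent isDoubleDescent : ℕ → List ℕ → Bool
isDoubleAscent  x σ = nb<x (leftNb x σ) x ∧ x<nb (rightNb x σ) x
isDoubleDescent x σ = x<nb (leftNb x σ) x ∧ nb<x (rightNb x σ) x

φ′ : ℕ → List ℕ → List ℕ
φ′ x σ = if isDoubleAscent x σ ∨ isDoubleDescent x σ then φ x σ else σ

-- Admissible inversions (0-based positions i, j in w).
-- (w_i , w_j) with i < j, w_i > w_j, and either w has an entry at position
-- i-1 with w_{i-1} < w_i, or some l with i < l < j has w_i < w_l.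
isAdmInv : (w : List ℕ) → Fin (length w) → Fin (length w) → Bool
isAdmInv w i j =
  (toℕ i <ᵇ toℕ j) ∧ (lookup w j <ᵇ lookup w i) ∧
  (any (λ k → (suc (toℕ k) ≡ᵇ toℕ i) ∧ (lookup w k <ᵇ lookup w i)) (allFin (length w))
   ∨ any (λ l → (toℕ i <ᵇ toℕ l) ∧ (toℕ l <ᵇ toℕ j) ∧ (lookup w i <ᵇ lookup w l)) (allFin (length w)))

count : {A : Set} → (A → Bool) → List A → ℕ
count p = foldr (λ a n → if p a then suc n else n) 0

ai : List ℕ → ℕ
ai w = foldr (λ i acc → count (isAdmInv w i) (allFin (length w)) + acc) 0 (allFin (length w))

-- An admissible inversion (a , c) is determined by the left neighbour of a and
-- the letters between a and c: if the neighbour is smaller than a, every later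
-- smaller c counts, otherwise only those after the first later letter exceeding a.
-- So ai is a sum of rows, one per letter.  If x is a double ascent (descent) its
-- right (left) neighbour exceeds x, so w₃ (w₂) is empty and φ_x merely moves x
-- across a run v of letters below x, which sits between a letter ≥ x (the end of
-- w₁) and a letter > x (the start of w₄).  The row of a letter of w₁ sees the same
-- letters after its first larger letter, up to order; the rows of v and of w₄ do
-- not change; and in either position the row of x counts the letters of w₄ below x.

module Submission where

open import Defs
open import Data.Bool using (Bool; true; false; _∧_; _∨_; if_then_else_; T)
open import Data.Bool.Properties using (∨-assoc; ∨-identityʳ; ∧-identityʳ; ∧-zeroʳ)
open import Data.Bool.ListAction using (any)
open import Data.Fin using (Fin; toℕ) renaming (zero to fzero; suc to fsuc)
open import Data.Fin.Properties using (toℕ<n)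
open import Data.List using (List; []; _∷_; _++_; _∷ʳ_; reverse; takeWhile; dropWhile; length; head; tabulate; allFin; lookup; foldr)
open import Data.List.Properties using (++-assoc; ++-identityʳ; reverse-++; reverse-involutive; unfold-reverse; takeWhile++dropWhile)
open import Data.List.Membership.Propositional using (_∈_; _∉_)
open import Data.List.Membership.Propositional.Properties using (∈-map⁺; ∈-upTo⁺)
open import Data.List.Relation.Binary.Permutation.Propositional using (_↭_; prep; swap; ↭-sym; ↭⇒↭ₛ)
  renaming (refl to ↭-refl; trans to ↭-trans)
open import Data.List.Relation.Binary.Permutation.Propositional.Properties using (All-resp-↭; ∈-resp-↭; ↭-reverse; ++⁺ˡ; shift)
open import Data.List.Relation.Unary.All as All using (All; []; _∷_)
open import Data.List.Relation.Unary.All.Properties using (all-takeWhile; all-head-dropWhile)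
open import Data.List.Relation.Unary.Any using (here; there)
open import Data.List.Relation.Unary.Unique.Propositional using (Unique)
open import Data.List.Relation.Unary.AllPairs using (_∷_)
open import Data.List.Relation.Unary.Unique.Propositional.Properties using (Unique[x∷xs]⇒x∉xs; map⁺; upTo⁺)
open import Data.Maybe using (Maybe; just; nothing)
open import Data.Maybe.Relation.Unary.All as Maybe using (just; nothing)
open import Data.Nat using (ℕ; zero; suc; _+_; _<_; _≤_; _<ᵇ_; _≡ᵇ_; _<?_; _≤?_; z≤n; s≤s)
open import Data.Nat.Properties
open import Algebra.Properties.CommutativeSemigroup +-commutativeSemigroup using (x∙yz≈y∙xz)
open import Data.Product using (proj₁; proj₂)
open import Data.Empty using (⊥-elim)
open import Data.Sum as Sum using (_⊎_; inj₁; inj₂)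
open import Function using (_∘_)
open import Relation.Nullary using (yes; no; ¬_)
open import Relation.Nullary.Decidable using (dec-true; dec-false)
open import Relation.Unary using (Pred; Decidable)
open import Relation.Binary.PropositionalEquality
open import Relation.Binary.PropositionalEquality.Properties using (setoid)
open import Data.List.Relation.Binary.Permutation.Setoid.Properties (setoid ℕ) using (Unique-resp-↭)

<ᵇ-true : ∀ {m n} → m < n → (m <ᵇ n) ≡ true
<ᵇ-true (s≤s z≤n)       = refl
<ᵇ-true (s≤s (s≤s m<n)) = <ᵇ-true (s≤s m<n)

<ᵇ-false : ∀ {m n} → n ≤ m → (m <ᵇ n) ≡ false
<ᵇ-false z≤n       = refl
<ᵇ-false (s≤s n≤m) = <ᵇ-false n≤m

count-erase : ∀ {A : Set} (p : A → Bool) xs {y} ys → p y ≡ false →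
              count p (xs ++ y ∷ ys) ≡ count p (xs ++ ys)
count-erase p []       ys py rewrite py = refl
count-erase p (x ∷ xs) ys py = cong (λ n → if p x then suc n else n) (count-erase p xs ys py)

count-↭ : ∀ {A : Set} (p : A → Bool) {xs ys} → xs ↭ ys → count p xs ≡ count p ys
count-↭ p ↭-refl = refl
count-↭ p (prep x xs↭ys) = cong (λ n → if p x then suc n else n) (count-↭ p xs↭ys)
count-↭ p (swap x y xs↭ys) with p x | p y
... | true  | true  = cong (suc ∘ suc) (count-↭ p xs↭ys)
... | true  | false = cong suc (count-↭ p xs↭ys)
... | false | true  = cong suc (count-↭ p xs↭ys)
... | false | false = count-↭ p xs↭ys
count-↭ p (↭-trans xs↭ys ys↭zs) = trans (count-↭ p xs↭ys) (count-↭ p ys↭zs)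

module _ {A : Set} {ℓ} {P : Pred A ℓ} (P? : Decidable P) where

  dropWhile-accept : ∀ {x} xs → P x → dropWhile P? (x ∷ xs) ≡ dropWhile P? xs
  dropWhile-accept {x} xs px rewrite dec-true (P? x) px = refl

  dropWhile-reject : ∀ {x} xs → ¬ P x → dropWhile P? (x ∷ xs) ≡ x ∷ xs
  dropWhile-reject {x} xs ¬px rewrite dec-false (P? x) ¬px = refl

  dropWhile-++ : ∀ xs ys → All P xs → dropWhile P? (xs ++ ys) ≡ dropWhile P? ys
  dropWhile-++ []       ys []         = refl
  dropWhile-++ (x ∷ xs) ys (px ∷ pxs) = trans (dropWhile-accept (xs ++ ys) px) (dropWhile-++ xs ys pxs)

  takeWhile-reject : ∀ {x} xs → ¬ P x → takeWhile P? (x ∷ xs) ≡ []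
  takeWhile-reject {x} xs ¬px rewrite dec-false (P? x) ¬px = refl

-- Rows of admissible inversions

countLess : ℕ → List ℕ → ℕ
countLess a = count (_<ᵇ a)

-- aiRow β a s counts the admissible inversions (a , c) with c in the suffix s
-- following a, where β says whether a is preceded by a smaller letter.
aiRow : Bool → ℕ → List ℕ → ℕ
aiRow true  a s = countLess a s
aiRow false a s = countLess a (dropWhile (_≤? a) s)

-- The letter preceding the word is p; nothing plays the role of +∞.
aiAfter : Maybe ℕ → List ℕ → ℕ
aiAfter p []      = 0
aiAfter p (a ∷ s) = aiRow (nb<x p a) a s + aiAfter (just a) s

aiRow-false-≤ : ∀ {a c} l → c ≤ a → aiRow false a (c ∷ l) ≡ aiRow false a l
aiRow-false-≤ {a} l c≤a = cong (countLess a) (dropWhile-accept (_≤? a) l c≤a)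

aiRow-false-> : ∀ {a c} l → a < c → aiRow false a (c ∷ l) ≡ aiRow true a l
aiRow-false-> {a} {c} l a<c = begin
  countLess a (dropWhile (_≤? a) (c ∷ l)) ≡⟨ cong (countLess a) (dropWhile-reject (_≤? a) l (<⇒≱ a<c)) ⟩
  countLess a (c ∷ l)                     ≡⟨ count-erase (_<ᵇ a) [] l (<ᵇ-false (<⇒≤ a<c)) ⟩
  countLess a l                           ∎
  where open ≡-Reasoning

aiRow-false-++ : ∀ {a} l r → All (_≤ a) l → aiRow false a (l ++ r) ≡ aiRow false a r
aiRow-false-++ {a} l r l≤a = cong (countLess a) (dropWhile-++ (_≤? a) l r l≤a)

aiRow-false-headAbove : ∀ {a} t → Maybe.All (a <_) (head t) → aiRow false a t ≡ aiRow true a t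
aiRow-false-headAbove     []      nothing    = refl
aiRow-false-headAbove {a} (c ∷ t) (just a<c) =
  trans (aiRow-false-> t a<c) (sym (count-erase (_<ᵇ a) [] t (<ᵇ-false (<⇒≤ a<c))))

aiRow-∷ : ∀ β a b w → aiRow β a (b ∷ w) ≡
          (if (b <ᵇ a) ∧ β then suc (aiRow (β ∨ (a <ᵇ b)) a w) else aiRow (β ∨ (a <ᵇ b)) a w)
aiRow-∷ true  a b w rewrite ∧-identityʳ (b <ᵇ a) = refl
aiRow-∷ false a b w rewrite ∧-zeroʳ (b <ᵇ a) with b ≤? a
... | yes b≤a rewrite <ᵇ-false b≤a       = aiRow-false-≤ w b≤a
... | no  b≰a rewrite <ᵇ-true (≰⇒> b≰a) = aiRow-false-> w (≰⇒> b≰a)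

-- Total indexing; the junk value 0 out of range is never inspected.
infixl 9 _!_
_!_ : List ℕ → ℕ → ℕ
[]      ! _     = 0
(a ∷ w) ! zero  = a
(a ∷ w) ! suc k = w ! k

lookup-! : ∀ w (i : Fin (length w)) → lookup w i ≡ w ! toℕ i
lookup-! (a ∷ w) fzero    = refl
lookup-! (a ∷ w) (fsuc i) = lookup-! w i

anyUpTo : (ℕ → Bool) → ℕ → Bool
anyUpTo f zero    = false
anyUpTo f (suc m) = f 0 ∨ anyUpTo (f ∘ suc) m

countUpTo : (ℕ → Bool) → ℕ → ℕ
countUpTo f zero    = 0
countUpTo f (suc m) = if f 0 then suc (countUpTo (f ∘ suc) m) else countUpTo (f ∘ suc) m

sumUpTo : (ℕ → ℕ) → ℕ → ℕ
sumUpTo f zero    = 0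
sumUpTo f (suc m) = f 0 + sumUpTo (f ∘ suc) m

countUpTo-cong : ∀ {f g} m → (∀ k → f k ≡ g k) → countUpTo f m ≡ countUpTo g m
countUpTo-cong         zero    _   = refl
countUpTo-cong {f} {g} (suc m) f≗g rewrite f≗g 0 | countUpTo-cong {f ∘ suc} {g ∘ suc} m (f≗g ∘ suc) = refl

sumUpTo-cong : ∀ {f g} m → (∀ k → f k ≡ g k) → sumUpTo f m ≡ sumUpTo g m
sumUpTo-cong zero    _   = refl
sumUpTo-cong (suc m) f≗g = cong₂ _+_ (f≗g 0) (sumUpTo-cong m (f≗g ∘ suc))

anyUpTo-false : ∀ {f} m → (∀ k → f k ≡ false) → anyUpTo f m ≡ false
anyUpTo-false zero    _       = refl
anyUpTo-false (suc m) f≗false rewrite f≗false 0 = anyUpTo-false m (f≗false ∘ suc)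

anyUpTo-≡ᵇ : ∀ g {i m} → i < m → anyUpTo (λ k → (k ≡ᵇ i) ∧ g k) m ≡ g i
anyUpTo-≡ᵇ g {zero}  {suc m} _         = trans (cong (g 0 ∨_) (anyUpTo-false m (λ _ → refl))) (∨-identityʳ (g 0))
anyUpTo-≡ᵇ g {suc i} {suc m} (s≤s i<m) = anyUpTo-≡ᵇ (g ∘ suc) i<m

any-tabulate : ∀ {n m} (g : Fin n → Bool) (f : Fin m → Fin n) h →
               (∀ i → g (f i) ≡ h (toℕ i)) → any g (tabulate f) ≡ anyUpTo h m
any-tabulate {m = zero}  g f h gf≗h = refl
any-tabulate {m = suc m} g f h gf≗h =
  cong₂ _∨_ (gf≗h fzero) (any-tabulate g (f ∘ fsuc) (h ∘ suc) (gf≗h ∘ fsuc))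

count-tabulate : ∀ {n m} (g : Fin n → Bool) (f : Fin m → Fin n) h →
                 (∀ i → g (f i) ≡ h (toℕ i)) → count g (tabulate f) ≡ countUpTo h m
count-tabulate {m = zero}  g f h gf≗h = refl
count-tabulate {m = suc m} g f h gf≗h
  rewrite gf≗h fzero | count-tabulate g (f ∘ fsuc) (h ∘ suc) (gf≗h ∘ fsuc) = refl

sum-tabulate : ∀ {n m} (g : Fin n → ℕ) (f : Fin m → Fin n) h →
               (∀ i → g (f i) ≡ h (toℕ i)) → foldr (λ i s → g i + s) 0 (tabulate f) ≡ sumUpTo h m
sum-tabulate {m = zero}  g f h gf≗h = refl
sum-tabulate {m = suc m} g f h gf≗h =
  cong₂ _+_ (gf≗h fzero) (sum-tabulate g (f ∘ fsuc) (h ∘ suc) (gf≗h ∘ fsuc))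

letterBefore : Maybe ℕ → List ℕ → ℕ → Maybe ℕ
letterBefore p w zero    = p
letterBefore p w (suc i) = just (w ! i)

-- isAdmInv on positions in ℕ, for a word whose first letter is preceded by p.
admissible : Maybe ℕ → List ℕ → ℕ → ℕ → Bool
admissible p w i j = (i <ᵇ j) ∧ (w ! j <ᵇ w ! i) ∧
  (nb<x (letterBefore p w i) (w ! i) ∨ anyUpTo (λ l → (i <ᵇ l) ∧ (l <ᵇ j) ∧ (w ! i <ᵇ w ! l)) (length w))

aiTable : Maybe ℕ → List ℕ → ℕ
aiTable p w = sumUpTo (λ i → countUpTo (admissible p w i) (length w)) (length w)

ascentAt : ∀ w {i} → i < length w →
           anyUpTo (λ k → (suc k ≡ᵇ i) ∧ (w ! k <ᵇ w ! i)) (length w) ≡ nb<x (letterBefore nothing w i) (w ! i)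
ascentAt w {zero}  _        = anyUpTo-false (length w) (λ _ → refl)
ascentAt w {suc i} 1+i<∣w∣ = anyUpTo-≡ᵇ (λ k → w ! k <ᵇ w ! suc i) (<-trans (n<1+n i) 1+i<∣w∣)

isAdmInv≡admissible : ∀ w i j → isAdmInv w i j ≡ admissible nothing w (toℕ i) (toℕ j)
isAdmInv≡admissible w i j rewrite lookup-! w i | lookup-! w j =
  cong₂ (λ b c → (toℕ i <ᵇ toℕ j) ∧ (w ! toℕ j <ᵇ w ! toℕ i) ∧ (b ∨ c)) ascent largerBetween
  where
  ascent : any (λ k → (suc (toℕ k) ≡ᵇ toℕ i) ∧ (lookup w k <ᵇ w ! toℕ i)) (allFin (length w))
           ≡ nb<x (letterBefore nothing w (toℕ i)) (w ! toℕ i)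
  ascent = trans (any-tabulate _ (λ k → k) _ (λ k → cong (λ c → (suc (toℕ k) ≡ᵇ toℕ i) ∧ (c <ᵇ w ! toℕ i)) (lookup-! w k)))
                 (ascentAt w (toℕ<n i))
  largerBetween : any (λ l → (toℕ i <ᵇ toℕ l) ∧ (toℕ l <ᵇ toℕ j) ∧ (w ! toℕ i <ᵇ lookup w l)) (allFin (length w))
                  ≡ anyUpTo (λ l → (toℕ i <ᵇ l) ∧ (l <ᵇ toℕ j) ∧ (w ! toℕ i <ᵇ w ! l)) (length w)
  largerBetween = any-tabulate _ (λ l → l) _
    (λ l → cong (λ c → (toℕ i <ᵇ toℕ l) ∧ (toℕ l <ᵇ toℕ j) ∧ (w ! toℕ i <ᵇ c)) (lookup-! w l))

ai≡aiTable : ∀ w → ai w ≡ aiTable nothing w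
ai≡aiTable w = sum-tabulate _ (λ i → i) _ (λ i → count-tabulate _ (λ j → j) _ (isAdmInv≡admissible w i))

biggerBefore : List ℕ → ℕ → ℕ → Bool
biggerBefore w a j = anyUpTo (λ l → (l <ᵇ j) ∧ (a <ᵇ w ! l)) (length w)

countUpTo≡aiRow : ∀ w a β → countUpTo (λ j → (w ! j <ᵇ a) ∧ (β ∨ biggerBefore w a j)) (length w) ≡ aiRow β a w
countUpTo≡aiRow []      a true  = refl
countUpTo≡aiRow []      a false = refl
countUpTo≡aiRow (b ∷ w) a β = trans (cong₂ (λ c n → if c then suc n else n) first rest) (sym (aiRow-∷ β a b w))
  where
  first : (b <ᵇ a) ∧ (β ∨ biggerBefore (b ∷ w) a 0) ≡ (b <ᵇ a) ∧ β
  first = cong ((b <ᵇ a) ∧_) (trans (cong (β ∨_) (anyUpTo-false (length w) (λ _ → refl))) (∨-identityʳ β))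
  rest : countUpTo (λ j → (w ! j <ᵇ a) ∧ (β ∨ biggerBefore (b ∷ w) a (suc j))) (length w) ≡ aiRow (β ∨ (a <ᵇ b)) a w
  rest = trans (countUpTo-cong (length w) (λ j → cong ((w ! j <ᵇ a) ∧_) (sym (∨-assoc β (a <ᵇ b) (biggerBefore w a j)))))
               (countUpTo≡aiRow w a (β ∨ (a <ᵇ b)))

admissible-∷ : ∀ p a w i j → admissible p (a ∷ w) (suc i) (suc j) ≡ admissible (just a) w i j
admissible-∷ p a w zero    j = refl
admissible-∷ p a w (suc i) j = refl

-- Row 0 of the table unfolds to the count of countUpTo≡aiRow, and the other
-- rows to those of aiTable (just a) w shifted by one position.
aiTable-∷ : ∀ p a w → aiTable p (a ∷ w) ≡ aiRow (nb<x p a) a w + aiTable (just a) w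
aiTable-∷ p a w = cong₂ _+_ (countUpTo≡aiRow w a (nb<x p a))
  (sumUpTo-cong (length w) (λ i → countUpTo-cong (length w) (admissible-∷ p a w i)))

aiTable≡aiAfter : ∀ p w → aiTable p w ≡ aiAfter p w
aiTable≡aiAfter p []      = refl
aiTable≡aiAfter p (a ∷ w) = trans (aiTable-∷ p a w) (cong (aiRow (nb<x p a) a w +_) (aiTable≡aiAfter (just a) w))

ai≡aiAfter : ∀ w → ai w ≡ aiAfter nothing w
ai≡aiAfter w = trans (ai≡aiTable w) (aiTable≡aiAfter nothing w)

-- Moving a letter across a run of smaller letters

lastOr : Maybe ℕ → List ℕ → Maybe ℕ
lastOr p []      = p
lastOr p (a ∷ u) = lastOr (just a) u

nb<x-false : ∀ {x y} p → Maybe.All (x ≤_) p → y ≤ x → nb<x p y ≡ false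
nb<x-false nothing  nothing        _   = refl
nb<x-false (just c) (just x≤c) y≤x = <ᵇ-false (≤-trans y≤x x≤c)

lastOr-mono : ∀ {x c a} u → c ≤ a → Maybe.All (x ≤_) (lastOr (just c) u) → Maybe.All (x ≤_) (lastOr (just a) u)
lastOr-mono []      c≤a (just x≤c) = just (≤-trans x≤c c≤a)
lastOr-mono (_ ∷ _) _   x≤last     = x≤last

aiAfter-prev : ∀ {a b} t → Maybe.All (a <_) (head t) → Maybe.All (b <_) (head t) →
               aiAfter (just a) t ≡ aiAfter (just b) t
aiAfter-prev []      _          _          = refl
aiAfter-prev (c ∷ t) (just a<c) (just b<c) rewrite <ᵇ-true a<c | <ᵇ-true b<c = refl

aiRow-shift : ∀ {x v} → All (_< x) v → ∀ β u t a → Maybe.All (x ≤_) (lastOr (just a) u) →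
              aiRow β a (u ++ v ++ x ∷ t) ≡ aiRow β a (u ++ x ∷ v ++ t)
aiRow-shift {x} {v} _ true u t a _ = count-↭ _ (++⁺ˡ u (shift x v t))
aiRow-shift {x} {v} v<x false [] t a (just x≤a) = begin
  aiRow false a (v ++ x ∷ t)   ≡⟨ aiRow-false-++ v _ v≤a ⟩
  aiRow false a (x ∷ t)        ≡⟨ aiRow-false-≤ t x≤a ⟩
  aiRow false a t              ≡⟨ sym (aiRow-false-++ (x ∷ v) t (x≤a ∷ v≤a)) ⟩
  aiRow false a (x ∷ v ++ t)   ∎
  where
  open ≡-Reasoning
  v≤a : All (_≤ a) v
  v≤a = All.map (λ y<x → ≤-trans (<⇒≤ y<x) x≤a) v<x
aiRow-shift {x} {v} v<x false (c ∷ u) t a x≤last with c ≤? a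
... | yes c≤a = begin
  aiRow false a (c ∷ u ++ v ++ x ∷ t) ≡⟨ aiRow-false-≤ _ c≤a ⟩
  aiRow false a (u ++ v ++ x ∷ t)     ≡⟨ aiRow-shift v<x false u t a (lastOr-mono u c≤a x≤last) ⟩
  aiRow false a (u ++ x ∷ v ++ t)     ≡⟨ sym (aiRow-false-≤ _ c≤a) ⟩
  aiRow false a (c ∷ u ++ x ∷ v ++ t) ∎
  where open ≡-Reasoning
... | no c≰a = begin
  aiRow false a (c ∷ u ++ v ++ x ∷ t) ≡⟨ aiRow-false-> _ (≰⇒> c≰a) ⟩
  aiRow true a (u ++ v ++ x ∷ t)      ≡⟨ count-↭ _ (++⁺ˡ u (shift x v t)) ⟩
  aiRow true a (u ++ x ∷ v ++ t)      ≡⟨ sym (aiRow-false-> _ (≰⇒> c≰a)) ⟩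
  aiRow false a (c ∷ u ++ x ∷ v ++ t) ∎
  where open ≡-Reasoning

module _ {x : ℕ} {t : List ℕ} (x<t : Maybe.All (x <_) (head t)) where

  aiRow-erase : ∀ β b r → b < x → aiRow β b (r ++ x ∷ t) ≡ aiRow β b (r ++ t)
  aiRow-erase true  b r       b<x = count-erase (_<ᵇ b) r t (<ᵇ-false (<⇒≤ b<x))
  aiRow-erase false b []      b<x =
    trans (aiRow-false-> t b<x) (sym (aiRow-false-headAbove t (Maybe.map (<-trans b<x) x<t)))
  aiRow-erase false b (c ∷ r) b<x with c ≤? b
  ... | yes c≤b = begin
    aiRow false b (c ∷ r ++ x ∷ t) ≡⟨ aiRow-false-≤ _ c≤b ⟩
    aiRow false b (r ++ x ∷ t)     ≡⟨ aiRow-erase false b r b<x ⟩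
    aiRow false b (r ++ t)         ≡⟨ sym (aiRow-false-≤ _ c≤b) ⟩
    aiRow false b (c ∷ r ++ t)     ∎
    where open ≡-Reasoning
  ... | no c≰b = begin
    aiRow false b (c ∷ r ++ x ∷ t) ≡⟨ aiRow-false-> _ (≰⇒> c≰b) ⟩
    aiRow true b (r ++ x ∷ t)      ≡⟨ aiRow-erase true b r b<x ⟩
    aiRow true b (r ++ t)          ≡⟨ sym (aiRow-false-> _ (≰⇒> c≰b)) ⟩
    aiRow false b (c ∷ r ++ t)     ∎
    where open ≡-Reasoning

  aiAfter-insert : ∀ w {a} → a < x → All (_< x) w →
                   aiAfter (just a) (w ++ x ∷ t) ≡ countLess x t + aiAfter (just a) (w ++ t)
  aiAfter-insert [] {a} a<x [] rewrite <ᵇ-true a<x =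
    cong (countLess x t +_) (aiAfter-prev t x<t (Maybe.map (<-trans a<x) x<t))
  aiAfter-insert (b ∷ w) {a} a<x (b<x ∷ w<x) = begin
    aiRow (a <ᵇ b) b (w ++ x ∷ t) + aiAfter (just b) (w ++ x ∷ t)
      ≡⟨ cong₂ _+_ (aiRow-erase (a <ᵇ b) b w b<x) (aiAfter-insert w b<x w<x) ⟩
    aiRow (a <ᵇ b) b (w ++ t) + (countLess x t + aiAfter (just b) (w ++ t))
      ≡⟨ x∙yz≈y∙xz (aiRow (a <ᵇ b) b (w ++ t)) (countLess x t) _ ⟩
    countLess x t + (aiRow (a <ᵇ b) b (w ++ t) + aiAfter (just b) (w ++ t)) ∎
    where open ≡-Reasoning

  -- x contributes countLess x t at either end of v: after v it follows a
  -- smaller letter, and in front of v the letters of v all come before the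
  -- first letter above x.
  aiAfter-moveFront : ∀ p v → Maybe.All (x ≤_) p → All (_< x) v →
                      aiAfter p (v ++ x ∷ t) ≡ aiAfter p (x ∷ v ++ t)
  aiAfter-moveFront p []      _   []          = refl
  aiAfter-moveFront p (b ∷ w) x≤p (b<x ∷ w<x) = begin
    aiRow (nb<x p b) b (w ++ x ∷ t) + aiAfter (just b) (w ++ x ∷ t)
      ≡⟨ cong₂ _+_ bRow (aiAfter-insert w b<x w<x) ⟩
    aiRow false b (w ++ t) + (countLess x t + aiAfter (just b) (w ++ t))
      ≡⟨ x∙yz≈y∙xz (aiRow false b (w ++ t)) (countLess x t) _ ⟩
    countLess x t + (aiRow false b (w ++ t) + aiAfter (just b) (w ++ t))
      ≡⟨ cong₂ (λ n β → n + (aiRow β b (w ++ t) + aiAfter (just b) (w ++ t))) (sym xRow) (sym (<ᵇ-false (<⇒≤ b<x))) ⟩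
    aiRow (nb<x p x) x (b ∷ w ++ t) + aiAfter (just x) (b ∷ w ++ t) ∎
    where
    open ≡-Reasoning
    bRow : aiRow (nb<x p b) b (w ++ x ∷ t) ≡ aiRow false b (w ++ t)
    bRow rewrite nb<x-false p x≤p (<⇒≤ b<x) = aiRow-erase false b w b<x
    xRow : aiRow (nb<x p x) x (b ∷ w ++ t) ≡ countLess x t
    xRow rewrite nb<x-false p x≤p ≤-refl =
      trans (aiRow-false-++ (b ∷ w) t (All.map <⇒≤ (b<x ∷ w<x))) (aiRow-false-headAbove t x<t)

aiAfter-swap : ∀ {x v t} → All (_< x) v → Maybe.All (x <_) (head t) → ∀ u p →
               Maybe.All (x ≤_) (lastOr p u) → aiAfter p (u ++ v ++ x ∷ t) ≡ aiAfter p (u ++ x ∷ v ++ t)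
aiAfter-swap {v = v} v<x x<t []      p x≤p    = aiAfter-moveFront x<t p v x≤p v<x
aiAfter-swap         v<x x<t (a ∷ u) p x≤last =
  cong₂ _+_ (aiRow-shift v<x (nb<x p a) u _ a x≤last) (aiAfter-swap v<x x<t u (just a) x≤last)

ai-swap : ∀ {x} u v t → Maybe.All (x ≤_) (lastOr nothing u) → All (_< x) v → Maybe.All (x <_) (head t) →
          ai (u ++ v ++ x ∷ t) ≡ ai (u ++ x ∷ v ++ t)
ai-swap {x} u v t x≤u v<x x<t = begin
  ai (u ++ v ++ x ∷ t)              ≡⟨ ai≡aiAfter (u ++ v ++ x ∷ t) ⟩
  aiAfter nothing (u ++ v ++ x ∷ t) ≡⟨ aiAfter-swap v<x x<t u nothing x≤u ⟩
  aiAfter nothing (u ++ x ∷ v ++ t) ≡⟨ sym (ai≡aiAfter (u ++ x ∷ v ++ t)) ⟩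
  ai (u ++ x ∷ v ++ t)              ∎
  where open ≡-Reasoning

ai-exchange : ∀ {x} u v w t → Maybe.All (x ≤_) (lastOr nothing u) → All (_< x) v → All (_< x) w →
              Maybe.All (x <_) (head t) → v ≡ [] ⊎ w ≡ [] → ai ((u ++ v) ++ x ∷ w ++ t) ≡ ai (u ++ w ++ x ∷ v ++ t)
ai-exchange {x} u v w t x≤u v<x w<x x<t (inj₁ refl) =
  trans (cong (λ u′ → ai (u′ ++ x ∷ w ++ t)) (++-identityʳ u)) (sym (ai-swap u w t x≤u w<x x<t))
ai-exchange {x} u v w t x≤u v<x w<x x<t (inj₂ refl) =
  trans (cong ai (++-assoc u v (x ∷ t))) (ai-swap u v t x≤u v<x x<t)

-- The x-factorization

splitAt-++ : ∀ x σ → x ∈ σ → proj₁ (splitAt x σ) ++ x ∷ proj₂ (splitAt x σ) ≡ σ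
splitAt-++ x (y ∷ ys) x∈σ with y ≡ᵇ x in y≡ᵇx
... | true = cong (_∷ ys) (sym (≡ᵇ⇒≡ y x (subst T (sym y≡ᵇx) _)))
... | false with x∈σ
...   | here refl   = ⊥-elim (subst T y≡ᵇx (≡⇒≡ᵇ y y refl))
...   | there x∈ys = cong (y ∷_) (splitAt-++ x ys x∈ys)

splitAt-∉ : ∀ x σ → Unique σ → x ∉ proj₂ (splitAt x σ)
splitAt-∉ x (y ∷ ys) !σ@(_ ∷ !ys) with y ≡ᵇ x in y≡ᵇx
... | true  = subst (_∉ ys) (≡ᵇ⇒≡ y x (subst T (sym y≡ᵇx) _)) (Unique[x∷xs]⇒x∉xs !σ)
... | false = splitAt-∉ x ys !ys

lastOr-∷ʳ : ∀ p l (h : ℕ) → lastOr p (l ∷ʳ h) ≡ just h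
lastOr-∷ʳ p []      h = refl
lastOr-∷ʳ p (a ∷ l) h = lastOr-∷ʳ (just a) l h

lastOr-reverse : ∀ d → lastOr nothing (reverse d) ≡ head d
lastOr-reverse []      = refl
lastOr-reverse (h ∷ d) = trans (cong (lastOr nothing) (unfold-reverse h d)) (lastOr-∷ʳ nothing (reverse d) h)

takeWhile<-[] : ∀ {x} r → x<nb (head r) x ≡ true → takeWhile (_<? x) r ≡ []
takeWhile<-[]     []      _   = refl
takeWhile<-[] {x} (y ∷ r) x<y = takeWhile-reject (_<? x) r (<⇒≯ (<ᵇ⇒< x y (subst T (sym x<y) _)))

dropWhile<-headAbove : ∀ x S → x ∉ S → Maybe.All (x <_) (head (dropWhile (_<? x) S))
dropWhile<-headAbove x []      _   = nothing
dropWhile<-headAbove x (y ∷ S) x∉S with y <? x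
... | yes y<x rewrite dropWhile-accept (_<? x) S y<x = dropWhile<-headAbove x S (x∉S ∘ there)
... | no  y≮x rewrite dropWhile-reject (_<? x) S y≮x = just (≤∧≢⇒< (≮⇒≥ y≮x) (x∉S ∘ here))

module _ (x : ℕ) (σ : List ℕ) where

  private
    P S : List ℕ
    P = proj₁ (splitAt x σ)
    S = proj₂ (splitAt x σ)

  w₁++w₂ : w₁ x σ ++ w₂ x σ ≡ P
  w₁++w₂ = begin
    reverse (dropWhile (_<? x) (reverse P)) ++ reverse (takeWhile (_<? x) (reverse P))
      ≡⟨ sym (reverse-++ (takeWhile (_<? x) (reverse P)) _) ⟩
    reverse (takeWhile (_<? x) (reverse P) ++ dropWhile (_<? x) (reverse P))
      ≡⟨ cong reverse (takeWhile++dropWhile (_<? x) (reverse P)) ⟩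
    reverse (reverse P)
      ≡⟨ reverse-involutive P ⟩
    P ∎
    where open ≡-Reasoning

  w₃++w₄ : w₃ x σ ++ w₄ x σ ≡ S
  w₃++w₄ = takeWhile++dropWhile (_<? x) S

  w₁-last≥ : Maybe.All (x ≤_) (lastOr nothing (w₁ x σ))
  w₁-last≥ = subst (Maybe.All (x ≤_)) (sym (lastOr-reverse (dropWhile (_<? x) (reverse P))))
                   (Maybe.map ≮⇒≥ (all-head-dropWhile (_<? x) (reverse P)))

  w₂<x : All (_< x) (w₂ x σ)
  w₂<x = All-resp-↭ (↭-sym (↭-reverse (takeWhile (_<? x) (reverse P)))) (all-takeWhile (_<? x) (reverse P))

  w₃<x : All (_< x) (w₃ x σ)
  w₃<x = all-takeWhile (_<? x) S

  w₄-head> : Unique σ → Maybe.All (x <_) (head (w₄ x σ))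
  w₄-head> !σ = dropWhile<-headAbove x S (splitAt-∉ x σ !σ)

  w₂≡[] : x<nb (leftNb x σ) x ≡ true → w₂ x σ ≡ []
  w₂≡[] = cong reverse ∘ takeWhile<-[] (reverse P)

  w₃≡[] : x<nb (rightNb x σ) x ≡ true → w₃ x σ ≡ []
  w₃≡[] = takeWhile<-[] S

  ai-φ : x ∈ σ → Unique σ → w₂ x σ ≡ [] ⊎ w₃ x σ ≡ [] → ai σ ≡ ai (φ x σ)
  ai-φ x∈σ !σ = trans (cong ai (sym factorization)) ∘
    ai-exchange (w₁ x σ) (w₂ x σ) (w₃ x σ) (w₄ x σ) w₁-last≥ w₂<x w₃<x (w₄-head> !σ)
    where
    factorization : (w₁ x σ ++ w₂ x σ) ++ x ∷ w₃ x σ ++ w₄ x σ ≡ σ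
    factorization = trans (cong₂ (λ P S → P ++ x ∷ S) w₁++w₂ w₃++w₄) (splitAt-++ x σ x∈σ)

  doubleRun⇒largerNeighbour : (isDoubleAscent x σ ∨ isDoubleDescent x σ) ≡ true →
                              x<nb (leftNb x σ) x ≡ true ⊎ x<nb (rightNb x σ) x ≡ true
  doubleRun⇒largerNeighbour with nb<x (leftNb x σ) x | x<nb (leftNb x σ) x | x<nb (rightNb x σ) x
  ... | _     | true  | _     = λ _ → inj₁ refl
  ... | _     | false | true  = λ _ → inj₂ refl
  ... | true  | false | false = λ ()
  ... | false | false | false = λ ()

  ai-φ′ : x ∈ σ → Unique σ → ai σ ≡ ai (φ′ x σ)
  ai-φ′ x∈σ !σ with isDoubleAscent x σ ∨ isDoubleDescent x σ in doubleRun
  ... | true  = ai-φ x∈σ !σ (Sum.map w₂≡[] w₃≡[] (doubleRun⇒largerNeighbour doubleRun))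
  ... | false = refl

[1‥n]-unique : ∀ n → Unique [1‥ n ]
[1‥n]-unique n = map⁺ suc-injective (upTo⁺ n)

∈-[1‥n] : ∀ {n x} → 1 ≤ x → x ≤ n → x ∈ [1‥ n ]
∈-[1‥n] {x = suc k} _ k<n = ∈-map⁺ suc (∈-upTo⁺ k<n)

lemma2p1 : (n : ℕ) (σ : List ℕ) → σ ↭ [1‥ n ] →
           (x : ℕ) → 1 ≤ x → x ≤ n → ai σ ≡ ai (φ′ x σ)
lemma2p1 n σ σ↭[1‥n] x 1≤x x≤n = ai-φ′ x σ
  (∈-resp-↭ (↭-sym σ↭[1‥n]) (∈-[1‥n] 1≤x x≤n))
  (Unique-resp-↭ (↭⇒↭ₛ (↭-sym σ↭[1‥n])) ([1‥n]-unique n))
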